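{- Let $\mathbf{D}\in\mathbb{N}^{k\times n}$ be a tree degree matrix without common leaves, with $k\ge 4$ and $n\ge 2k+2$. Then in any caterpillar realization of $\mathbf{D}$, among any $k-1$ of the $k$ caterpillars there is one that contains a path of length at least $2k+1$.
   Context: A tree degree sequence $d_1,\dots,d_n$ is a sequence of positive integers with $\sum_j d_j=2n-2$. A $k\times n$ matrix is a tree degree matrix if each row is a tree degree sequence; it has no common leaves if each column contains at most one entry equal to $1$. A realization of $\mathbf{D}=(d_{i,j})$ is a simple graph on vertices $v_1,\dots,v_n$ with edges colored by $k$ colors such that, for each $i$, the edges of color $i$ form a graph in which $v_j$ has degree $d_{i,j}$. A leaf is a vertex of degree $1$; a caterpillar is a tree whose non-leaf vertices form a path (the backbone). A caterpillar realization is a realization in which every color class is a (spanning) caterpillar. The length of a path is its number of edges. -}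

module Defs where

open import Data.Nat using (ℕ; _≤_; _+_; _*_; _∸_)
open import Data.Fin using (Fin)
open import Data.Fin.Properties using () renaming (_≟_ to _≟ᶠ_)
open import Data.List using (List; length; filter; map; allFin; _∷_; [])
open import Data.Nat.ListAction using (sum)
open import Data.List.Relation.Unary.Linked using (Linked)
open import Data.List.Relation.Unary.Unique.Propositional using (Unique)
open import Data.List.Membership.Propositional using (_∈_)
open import Data.Maybe using (Maybe; just; nothing)
open import Data.Maybe.Properties using (≡-dec)
open import Data.Product using (_×_; ∃)
open import Relation.Binary.PropositionalEquality using (_≡_; _≢_)
open import Relation.Binary.Construct.Closure.ReflexiveTransitive using (Star)
open import Relation.Nullary using (Dec; ¬_)
open import Relation.Unary using (Decidable)
open import Function.Bundles using (_⇔_)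

Graph : ℕ → Set₁
Graph n = Fin n → Fin n → Set

degree : ∀ {n} (E : Graph n) → (∀ u v → Dec (E u v)) → Fin n → ℕ
degree {n} E E? v = length (filter (E? v) (allFin n))

-- a path: a list of pairwise distinct vertices, consecutive ones adjacent.
-- Its length (number of edges) is (length of the list) - 1.
IsPath : ∀ {n} → Graph n → List (Fin n) → Set
IsPath E p = Unique p × Linked E p

HasPathOfLength≥ : ∀ {n} → Graph n → ℕ → Set
HasPathOfLength≥ E L = ∃ λ p → IsPath E p × (L + 1 ≤ length p)

Connected : ∀ {n} → Graph n → Set
Connected E = ∀ u v → Star E u v

HasCycle : ∀ {n} → Graph n → Set
HasCycle E = ∃ λ v₀ → ∃ λ vs → ∃ λ vₘ →
  IsPath E (v₀ ∷ vs Data.List.++ (vₘ ∷ [])) × 1 ≤ length vs × E vₘ v₀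

IsTree : ∀ {n} → Graph n → Set
IsTree E = Connected E × ¬ HasCycle E

IsCaterpillar : ∀ {n} (E : Graph n) → (∀ u v → Dec (E u v)) → Set
IsCaterpillar E E? = IsTree E ×
  ∃ λ backbone → IsPath E backbone × (∀ v → (v ∈ backbone) ⇔ (degree E E? v ≢ 1))

IsTreeDegreeSequence : ∀ {n} → (Fin n → ℕ) → Set
IsTreeDegreeSequence {n} d = (∀ j → 1 ≤ d j) × sum (map d (allFin n)) ≡ 2 * n ∸ 2

IsTreeDegreeMatrix : ∀ {k n} → (Fin k → Fin n → ℕ) → Set
IsTreeDegreeMatrix D = ∀ i → IsTreeDegreeSequence (D i)

NoCommonLeaves : ∀ {k n} → (Fin k → Fin n → ℕ) → Set
NoCommonLeaves D = ∀ j i i' → D i j ≡ 1 → D i' j ≡ 1 → i ≡ i'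

-- an edge-coloured simple graph on Fin n with k colours:
-- col u v = just i  iff  {u,v} is an edge of colour i; nothing iff no edge.
Colouring : ℕ → ℕ → Set
Colouring k n = Fin n → Fin n → Maybe (Fin k)

colourClass : ∀ {k n} → Colouring k n → Fin k → Graph n
colourClass col i u v = col u v ≡ just i

colourClass? : ∀ {k n} (col : Colouring k n) (i : Fin k) → ∀ u v → Dec (colourClass col i u v)
colourClass? col i u v = ≡-dec _≟ᶠ_ (col u v) (just i)

IsSimpleColouredGraph : ∀ {k n} → Colouring k n → Set
IsSimpleColouredGraph col = (∀ u v → col u v ≡ col v u) × (∀ v → col v v ≡ nothing)

IsRealization : ∀ {k n} → (Fin k → Fin n → ℕ) → Colouring k n → Set
IsRealization D col = IsSimpleColouredGraph col ×
  (∀ i j → degree (colourClass col i) (colourClass? col i) j ≡ D i j)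

IsCaterpillarRealization : ∀ {k n} → (Fin k → Fin n → ℕ) → Colouring k n → Set
IsCaterpillarRealization D col = IsRealization D col ×
  (∀ i → IsCaterpillar (colourClass col i) (colourClass? col i))

-- Every vertex is a leaf of colour i or lies on the backbone of the i-th caterpillar, so a
-- colour with ℓ leaves has a backbone of at least n − ℓ vertices; the backbone vertices have
-- degree ≥ 2, so in the tree the backbone extends by a leaf at each end to a path of length
-- ≥ n − ℓ + 1. It thus suffices to find a colour i ≠ c with at most n − 2k leaves. Otherwise
-- the k − 1 colours other than c each have at least n − 2k + 1 leaves and c has at least two,
-- while without common leaves the leaf counts of all colours sum to at most n; but
-- 2 + (k − 1)(n − 2k + 1) > n for k ≥ 4 and n ≥ 2k + 2.

module Submission where

open import Defs
open import Data.Nat using (ℕ; zero; suc; _≤_; _<_; _+_; _*_; pred; z≤n; s≤s)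
open import Data.Nat.Properties
open import Data.Nat.Tactic.RingSolver using (solve-∀)
open import Algebra.Properties.CommutativeSemigroup +-commutativeSemigroup using (interchange)
open import Data.Fin using (Fin)
open import Data.Fin.Properties using () renaming (_≟_ to _≟ᶠ_)
open import Data.List using (List; []; _∷_; _++_; _∷ʳ_; length; allFin; reverse; _ʳ++_)
open import Data.List.Properties using (length-tabulate; unfold-reverse; length-reverse; ++-assoc)
import Data.List.Relation.Unary.All as All
open import Data.List.Relation.Unary.All using (All; []; _∷_)
open import Data.List.Relation.Unary.All.Properties using (all-filter; ¬Any⇒All¬; ++⁻ˡ)
open import Data.List.Relation.Unary.Any as Any using (here; there; any?; satisfied)
open import Data.List.Relation.Unary.Any.Properties using (reverse⁺; reverse⁻)
open import Data.List.Relation.Unary.AllPairs using ([]; _∷_)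
open import Data.List.Relation.Unary.Linked using (Linked; []; [-]; _∷_)
open import Data.List.Relation.Unary.Unique.Propositional using (Unique)
open import Data.List.Relation.Unary.Unique.Propositional.Properties
  using (filter⁺; allFin⁺; Unique[x∷xs]⇒x∉xs)
open import Data.List.Relation.Binary.Permutation.Propositional using (↭⇒↭ₛ; ↭-sym)
open import Data.List.Relation.Binary.Permutation.Propositional.Properties using (↭-reverse)
import Data.List.Relation.Binary.Permutation.Setoid.Properties as Permutation
open import Data.List.Membership.Propositional using (_∈_; _∉_)
open import Data.List.Membership.Propositional.Properties using (∈-∃++; ∈-allFin)
import Data.List.Membership.DecPropositional as DecMembership
open import Data.Product using (_×_; ∃; ∃₂; _,_; proj₁; proj₂)
open import Data.Sum using (_⊎_; inj₁; inj₂)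
open import Data.Empty using (⊥-elim)
open import Data.Unit using (tt)
open import Function.Base using (_∘_)
open import Function.Bundles using (Equivalence; _⇔_)
open import Relation.Binary.Definitions using (DecidableEquality)
open import Relation.Binary.PropositionalEquality
open import Relation.Nullary using (Dec; yes; no; ¬_; contradiction)
open import Relation.Nullary.Decidable using (_×-dec_; ¬?)
open import Relation.Unary using (Decidable)

∑ : {A : Set} → (A → ℕ) → List A → ℕ
∑ f []       = 0
∑ f (x ∷ xs) = f x + ∑ f xs

𝟙 : {P : Set} → Dec P → ℕ
𝟙 (yes _) = 1
𝟙 (no _)  = 0

𝟙-no : {P : Set} (p : Dec P) → ¬ P → 𝟙 p ≡ 0
𝟙-no (yes p) ¬p = contradiction p ¬p
𝟙-no (no _)  _  = refl

𝟙-⊎ : {P Q R : Set} → (P → Q ⊎ R) → (p : Dec P) (q : Dec Q) (r : Dec R) → 𝟙 p ≤ 𝟙 q + 𝟙 r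
𝟙-⊎ split (no _)  q       r       = z≤n
𝟙-⊎ split (yes p) (yes _) r       = s≤s z≤n
𝟙-⊎ split (yes p) (no ¬q) (yes _) = s≤s z≤n
𝟙-⊎ split (yes p) (no ¬q) (no ¬r) with split p
... | inj₁ q = contradiction q ¬q
... | inj₂ r = contradiction r ¬r

module _ {A : Set} where

  ∑-cong : {f g : A → ℕ} → (∀ x → f x ≡ g x) → ∀ xs → ∑ f xs ≡ ∑ g xs
  ∑-cong f≗g []       = refl
  ∑-cong f≗g (x ∷ xs) = cong₂ _+_ (f≗g x) (∑-cong f≗g xs)

  ∑-mono-≤ : {f g : A → ℕ} → (∀ x → f x ≤ g x) → ∀ xs → ∑ f xs ≤ ∑ g xs
  ∑-mono-≤ f≤g []       = z≤n
  ∑-mono-≤ f≤g (x ∷ xs) = +-mono-≤ (f≤g x) (∑-mono-≤ f≤g xs)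

  ∑-+ : (f g : A → ℕ) → ∀ xs → ∑ (λ x → f x + g x) xs ≡ ∑ f xs + ∑ g xs
  ∑-+ f g []       = refl
  ∑-+ f g (x ∷ xs) = begin
    f x + g x + ∑ (λ x → f x + g x) xs ≡⟨ cong (f x + g x +_) (∑-+ f g xs) ⟩
    f x + g x + (∑ f xs + ∑ g xs)      ≡⟨ interchange (f x) (g x) (∑ f xs) (∑ g xs) ⟩
    f x + ∑ f xs + (g x + ∑ g xs)      ∎
    where open ≡-Reasoning

  ∑-length : (xs : List A) → ∑ (λ _ → 1) xs ≡ length xs
  ∑-length []       = refl
  ∑-length (x ∷ xs) = cong suc (∑-length xs)

  ∑-zero : (f : A → ℕ) → ∀ xs → (∀ x → x ∈ xs → f x ≡ 0) → ∑ f xs ≡ 0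
  ∑-zero f []       _  = refl
  ∑-zero f (x ∷ xs) f0 rewrite f0 x (here refl) = ∑-zero f xs (λ y y∈ → f0 y (there y∈))

  ∑-member : (f : A → ℕ) → ∀ {x xs} → x ∈ xs → f x ≤ ∑ f xs
  ∑-member f (here refl) = m≤m+n _ _
  ∑-member f (there x∈)  = ≤-trans (∑-member f x∈) (m≤n+m _ _)

  ∑-pair : (f : A → ℕ) → ∀ {x y xs} → Unique xs → x ∈ xs → y ∈ xs → x ≢ y → f x + f y ≤ ∑ f xs
  ∑-pair f _       (here refl) (here refl) x≢y = contradiction refl x≢y
  ∑-pair f _       (here refl) (there y∈)  _   = +-monoʳ-≤ _ (∑-member f y∈)
  ∑-pair f {x} {y} {_ ∷ xs} _ (there x∈) (here refl) _ =
    subst (_≤ f y + ∑ f xs) (+-comm (f y) (f x)) (+-monoʳ-≤ (f y) (∑-member f x∈))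
  ∑-pair f (_ ∷ u) (there x∈)  (there y∈)  x≢y = ≤-trans (∑-pair f u x∈ y∈ x≢y) (m≤n+m _ _)

  ∑-≥-const : (f : A → ℕ) (m : ℕ) → ∀ xs → (∀ x → x ∈ xs → m ≤ f x) → length xs * m ≤ ∑ f xs
  ∑-≥-const f m []       _  = z≤n
  ∑-≥-const f m (x ∷ xs) lb = +-mono-≤ (lb x (here refl)) (∑-≥-const f m xs (λ y y∈ → lb y (there y∈)))

  ∑-≥-except : (f : A → ℕ) (m : ℕ) → ∀ {c xs} → Unique xs → c ∈ xs → (∀ x → x ≢ c → m ≤ f x) →
               f c + pred (length xs) * m ≤ ∑ f xs
  ∑-≥-except f m {xs = c ∷ xs} (c∉ ∷ _) (here refl) lb =
    +-monoʳ-≤ (f c) (∑-≥-const f m xs (λ x x∈ → lb x (λ { refl → All.lookup c∉ x∈ refl })))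
  ∑-≥-except f m {c} {x ∷ y ∷ ys} (x∉ ∷ u) (there c∈) lb = begin
    f c + (m + length ys * m)       ≡⟨ x+[y+z]≡y+[x+z] (f c) m (length ys * m) ⟩
    m + (f c + length ys * m)       ≤⟨ +-mono-≤ (lb x (λ { refl → All.lookup x∉ c∈ refl }))
                                                (∑-≥-except f m u c∈ lb) ⟩
    f x + ∑ f (y ∷ ys)              ∎
    where
    open ≤-Reasoning
    x+[y+z]≡y+[x+z] : ∀ a b d → a + (b + d) ≡ b + (a + d)
    x+[y+z]≡y+[x+z] = solve-∀

  ∑-𝟙-atMostOne : {P : A → Set} (P? : Decidable P) → (∀ {x y} → P x → P y → x ≡ y) →
                  ∀ {xs} → Unique xs → ∑ (λ x → 𝟙 (P? x)) xs ≤ 1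
  ∑-𝟙-atMostOne P? unique {[]}     _         = z≤n
  ∑-𝟙-atMostOne P? unique {x ∷ xs} (x∉ ∷ u) with P? x
  ... | no _   = ∑-𝟙-atMostOne P? unique u
  ... | yes px = s≤s (≤-reflexive (∑-zero _ xs λ y y∈ →
                   𝟙-no (P? y) (λ py → All.lookup x∉ y∈ (unique px py))))

∑-swap : {A B : Set} (h : A → B → ℕ) → ∀ xs ys →
         ∑ (λ x → ∑ (h x) ys) xs ≡ ∑ (λ y → ∑ (λ x → h x y) xs) ys
∑-swap h []       ys = sym (∑-zero _ ys (λ _ _ → refl))
∑-swap h (x ∷ xs) ys = begin
  ∑ (h x) ys + ∑ (λ x → ∑ (h x) ys) xs           ≡⟨ cong (∑ (h x) ys +_) (∑-swap h xs ys) ⟩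
  ∑ (h x) ys + ∑ (λ y → ∑ (λ x → h x y) xs) ys   ≡⟨ ∑-+ _ _ ys ⟨
  ∑ (λ y → h x y + ∑ (λ x → h x y) xs) ys         ∎
  where open ≡-Reasoning

module _ {A : Set} (_≟ₐ_ : DecidableEquality A) where
  open DecMembership _≟ₐ_ using (_∈?_)

  ∑-𝟙-∈ : ∀ {xs} → Unique xs → ∀ ys → ∑ (λ x → 𝟙 (x ∈? ys)) xs ≤ length ys
  ∑-𝟙-∈ {xs} u []       = ≤-reflexive (∑-zero _ xs (λ _ _ → refl))
  ∑-𝟙-∈ {xs} u (y ∷ ys) = begin
    ∑ (λ x → 𝟙 (x ∈? y ∷ ys)) xs
      ≤⟨ ∑-mono-≤ (λ x → 𝟙-⊎ Any.toSum (x ∈? y ∷ ys) (x ≟ₐ y) (x ∈? ys)) xs ⟩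
    ∑ (λ x → 𝟙 (x ≟ₐ y) + 𝟙 (x ∈? ys)) xs
      ≡⟨ ∑-+ _ _ xs ⟩
    ∑ (λ x → 𝟙 (x ≟ₐ y)) xs + ∑ (λ x → 𝟙 (x ∈? ys)) xs
      ≤⟨ +-mono-≤ (∑-𝟙-atMostOne (_≟ₐ y) (λ p q → trans p (sym q)) u) (∑-𝟙-∈ u ys) ⟩
    1 + length ys
      ∎
    where open ≤-Reasoning

  length≤∑𝟙+length : {P : A → Set} (P? : Decidable P) → ∀ {xs} → Unique xs → ∀ ys →
                     (∀ x → ¬ P x → x ∈ ys) → length xs ≤ ∑ (λ x → 𝟙 (P? x)) xs + length ys
  length≤∑𝟙+length {P} P? {xs} u ys cover = begin
    length xs
      ≡⟨ ∑-length xs ⟨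
    ∑ (λ _ → 1) xs
      ≤⟨ ∑-mono-≤ (λ x → 𝟙-⊎ (λ _ → P-or-∈ x) (yes tt) (P? x) (x ∈? ys)) xs ⟩
    ∑ (λ x → 𝟙 (P? x) + 𝟙 (x ∈? ys)) xs
      ≡⟨ ∑-+ _ _ xs ⟩
    ∑ (λ x → 𝟙 (P? x)) xs + ∑ (λ x → 𝟙 (x ∈? ys)) xs
      ≤⟨ +-monoʳ-≤ _ (∑-𝟙-∈ u ys) ⟩
    ∑ (λ x → 𝟙 (P? x)) xs + length ys
      ∎
    where
    open ≤-Reasoning
    P-or-∈ : ∀ x → P x ⊎ x ∈ ys
    P-or-∈ x with P? x
    ... | yes px = inj₁ px
    ... | no ¬px = inj₂ (cover x ¬px)

reverse-∷-∷ : {A : Set} (u v : A) (vs : List A) →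
              ∃₂ λ z t → z ∈ v ∷ vs × reverse (u ∷ v ∷ vs) ≡ z ∷ t
reverse-∷-∷ u v vs with reverse (v ∷ vs) in eq | length-reverse (v ∷ vs)
... | z ∷ t | _ = z , t ∷ʳ u , reverse⁻ (subst (z ∈_) (sym eq) (here refl)) ,
                  trans (unfold-reverse u (v ∷ vs)) (cong (_∷ʳ u) eq)

module _ {A : Set} {R : A → A → Set} (sym : ∀ {x y} → R x y → R y x) where

  Linked-ʳ++ : ∀ {x xs acc} → Linked R (x ∷ xs) → Linked R (x ∷ acc) → Linked R (xs ʳ++ x ∷ acc)
  Linked-ʳ++ [-]     l = l
  Linked-ʳ++ (r ∷ l) m = Linked-ʳ++ l (sym r ∷ m)

  Linked-reverse : ∀ {xs} → Linked R xs → Linked R (reverse xs)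
  Linked-reverse []      = []
  Linked-reverse [-]     = [-]
  Linked-reverse (r ∷ l) = Linked-ʳ++ l (sym r ∷ [-])

Unique-reverse : {A : Set} {xs : List A} → Unique xs → Unique (reverse xs)
Unique-reverse {A} {xs} = Permutation.Unique-resp-↭ (setoid A) (↭⇒↭ₛ (↭-sym (↭-reverse xs)))

Unique-++⁻ˡ : {A : Set} (xs : List A) {ys : List A} → Unique (xs ++ ys) → Unique xs
Unique-++⁻ˡ []       _          = []
Unique-++⁻ˡ (x ∷ xs) (x∉ ∷ u) = ++⁻ˡ xs x∉ ∷ Unique-++⁻ˡ xs u

Linked-++⁻ˡ : {A : Set} {R : A → A → Set} (xs : List A) {ys : List A} → Linked R (xs ++ ys) → Linked R xs
Linked-++⁻ˡ []           _       = []
Linked-++⁻ˡ (x ∷ [])     _       = [-]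
Linked-++⁻ˡ (x ∷ y ∷ xs) (r ∷ l) = r ∷ Linked-++⁻ˡ (y ∷ xs) l

module _ {n : ℕ} {E : Graph n} where

  IsPath-++⁻ˡ : ∀ xs {ys} → IsPath E (xs ++ ys) → IsPath E xs
  IsPath-++⁻ˡ xs (u , l) = Unique-++⁻ˡ xs u , Linked-++⁻ˡ xs l

  IsPath-∷ : ∀ {w v p} → w ∉ v ∷ p → E w v → IsPath E (v ∷ p) → IsPath E (w ∷ v ∷ p)
  IsPath-∷ w∉ e (u , l) = ¬Any⇒All¬ _ w∉ ∷ u , e ∷ l

  IsPath-head∉ : ∀ {w p} → IsPath E (w ∷ p) → w ∉ p
  IsPath-head∉ (u , _) = Unique[x∷xs]⇒x∉xs u

  IsPath-reverse : (∀ {u v} → E u v → E v u) → ∀ {p} → IsPath E p → IsPath E (reverse p)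
  IsPath-reverse sym (u , l) = Unique-reverse u , Linked-reverse sym l

  HasPathOfLength≥-mono : ∀ {L M} → L ≤ M → HasPathOfLength≥ E M → HasPathOfLength≥ E L
  HasPathOfLength≥-mono L≤M (p , P , M<p) = p , P , ≤-trans (+-monoˡ-≤ 1 L≤M) M<p

  path-closes-cycle : ∀ {v a rest z} → IsPath E (v ∷ a ∷ rest) → z ∈ rest → E z v → HasCycle E
  path-closes-cycle {v} {a} {z = z} P z∈ ezv with ∈-∃++ z∈
  ... | pre , suf , refl = v , a ∷ pre , z , IsPath-++⁻ˡ (v ∷ a ∷ pre ∷ʳ z) P′ , s≤s z≤n , ezv
    where
    P′ : IsPath E ((v ∷ a ∷ pre ∷ʳ z) ++ suf)
    P′ = subst (IsPath E) (cong (λ t → v ∷ a ∷ t) (sym (++-assoc pre (z ∷ []) suf))) P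

module Forest {n : ℕ} (E : Graph n) (E? : ∀ u v → Dec (E u v))
              (E-sym : ∀ {u v} → E u v → E v u) (irrefl : ∀ {v} → ¬ E v v)
              (acyclic : ¬ HasCycle E) where

  open DecMembership (_≟ᶠ_ {n}) using (_∈?_)

  two-neighbours : ∀ v → 2 ≤ degree E E? v → ∃₂ λ x y → x ≢ y × E v x × E v y
  two-neighbours v = pick (filter⁺ (E? v) (allFin⁺ n)) (all-filter (E? v) (allFin n))
    where
    pick : ∀ {xs} → Unique xs → All (E v) xs → 2 ≤ length xs → ∃₂ λ x y → x ≢ y × E v x × E v y
    pick ((x≢y ∷ _) ∷ _) (ex ∷ ey ∷ _) _ = _ , _ , x≢y , ex , ey
    pick (_ ∷ []) (_ ∷ []) (s≤s ())

  -- Any other neighbour of the head lying on the path would close a cycle with it.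
  neighbour-on-path : ∀ {v a p x} → IsPath E (v ∷ a ∷ p) → E v x → x ∈ a ∷ p → x ≡ a
  neighbour-on-path P e (here refl) = refl
  neighbour-on-path P e (there x∈)  = ⊥-elim (acyclic (path-closes-cycle P x∈ (E-sym e)))

  neighbours-on-path-equal : ∀ {v p x y} → IsPath E (v ∷ p) → E v x → E v y →
                             x ∈ v ∷ p → y ∈ v ∷ p → x ≡ y
  neighbours-on-path-equal P ex ey (here refl) _           = contradiction ex irrefl
  neighbours-on-path-equal P ex ey (there _)   (here refl) = contradiction ey irrefl
  neighbours-on-path-equal {p = _ ∷ _} P ex ey (there x∈) (there y∈) =
    trans (neighbour-on-path P ex x∈) (sym (neighbour-on-path P ey y∈))

  extend-head : ∀ {v p} → IsPath E (v ∷ p) → 2 ≤ degree E E? v → ∃ λ w → IsPath E (w ∷ v ∷ p)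
  extend-head {v} {p} P 2≤deg with two-neighbours v 2≤deg
  ... | x , y , x≢y , ex , ey with x ∈? v ∷ p | y ∈? v ∷ p
  ...   | no x∉ | _      = x , IsPath-∷ x∉ (E-sym ex) P
  ...   | yes _ | no y∉  = y , IsPath-∷ y∉ (E-sym ey) P
  ...   | yes x∈ | yes y∈ = contradiction (neighbours-on-path-equal P ex ey x∈ y∈) x≢y

  extend-both-ends : ∀ {p} → IsPath E p → 1 ≤ length p → (∀ x → x ∈ p → 2 ≤ degree E E? x) →
                     ∃₂ λ u w → u ≢ w × u ∉ p × w ∉ p × HasPathOfLength≥ E (length p + 1)
  extend-both-ends {v ∷ vs} P _ 2≤deg
    with u , P₁ ← extend-head P (2≤deg v (here refl))
    with z , t , z∈ , reversed ← reverse-∷-∷ u v vs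
    with w , P₃ ← extend-head (subst (IsPath E) reversed (IsPath-reverse E-sym P₁)) (2≤deg z z∈) =
    u , w , (λ { refl → w∉ u∈ }) , IsPath-head∉ P₁ , (λ w∈ → w∉ (on-reversal (there w∈))) ,
    (w ∷ z ∷ t , P₃ , ≤-reflexive length-ok)
    where
    w∉ : w ∉ z ∷ t
    w∉ = IsPath-head∉ P₃
    on-reversal : ∀ {x} → x ∈ u ∷ v ∷ vs → x ∈ z ∷ t
    on-reversal x∈ = subst (_ ∈_) reversed (reverse⁺ x∈)
    u∈ : u ∈ z ∷ t
    u∈ = on-reversal (here refl)
    length-ok : length (v ∷ vs) + 1 + 1 ≡ length (w ∷ z ∷ t)
    length-ok = begin
      suc (length vs) + 1 + 1               ≡⟨ +-comm (suc (length vs) + 1) 1 ⟩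
      suc (suc (length vs) + 1)             ≡⟨ cong suc (+-comm (suc (length vs)) 1) ⟩
      suc (length (u ∷ v ∷ vs))             ≡⟨ cong suc (length-reverse (u ∷ v ∷ vs)) ⟨
      suc (length (reverse (u ∷ v ∷ vs)))   ≡⟨ cong (suc ∘ length) reversed ⟩
      length (w ∷ z ∷ t)                    ∎
      where open ≡-Reasoning

leafCount : ∀ {n} → (Fin n → ℕ) → ℕ
leafCount {n} d = ∑ (λ v → 𝟙 (d v ≟ 1)) (allFin n)

leafCount-cong : ∀ {n} {d d′ : Fin n → ℕ} → (∀ v → d v ≡ d′ v) → leafCount d ≡ leafCount d′
leafCount-cong {n} d≗d′ = ∑-cong (λ v → cong (λ x → 𝟙 (x ≟ 1)) (d≗d′ v)) (allFin n)

module Caterpillar {n : ℕ} {E : Graph n} {E? : ∀ u v → Dec (E u v)}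
                   (E-sym : ∀ {u v} → E u v → E v u) (irrefl : ∀ {v} → ¬ E v v)
                   (no-isolated : ∀ v → 1 ≤ degree E E? v)
                   (caterpillar : IsCaterpillar E E?) where

  private
    deg : Fin n → ℕ
    deg = degree E E?

    backbone : List (Fin n)
    backbone = proj₁ (proj₂ caterpillar)

    backbone-path : IsPath E backbone
    backbone-path = proj₁ (proj₂ (proj₂ caterpillar))

    on-backbone⇔non-leaf : ∀ v → v ∈ backbone ⇔ deg v ≢ 1
    on-backbone⇔non-leaf = proj₂ (proj₂ (proj₂ caterpillar))

  open Forest E E? E-sym irrefl (proj₂ (proj₁ caterpillar))

  off-backbone⇒leaf : ∀ v → v ∉ backbone → deg v ≡ 1
  off-backbone⇒leaf v v∉ with deg v ≟ 1
  ... | yes leaf    = leaf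
  ... | no non-leaf = contradiction (Equivalence.from (on-backbone⇔non-leaf v) non-leaf) v∉

  on-backbone⇒2≤deg : ∀ v → v ∈ backbone → 2 ≤ deg v
  on-backbone⇒2≤deg v v∈ with deg v | no-isolated v | Equivalence.to (on-backbone⇔non-leaf v) v∈
  ... | suc zero    | _ | non-leaf = contradiction refl non-leaf
  ... | suc (suc _) | _ | _        = s≤s (s≤s z≤n)

  n≤leafCount+backbone : n ≤ leafCount deg + length backbone
  n≤leafCount+backbone = subst (_≤ leafCount deg + length backbone) (length-tabulate (λ v → v))
    (length≤∑𝟙+length _≟ᶠ_ (λ v → deg v ≟ 1) (allFin⁺ n) backbone
      (λ v non-leaf → Equivalence.from (on-backbone⇔non-leaf v) non-leaf))

  few-leaves⇒long-backbone : ∀ {L} → leafCount deg + L ≤ n → L ≤ length backbone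
  few-leaves⇒long-backbone few-leaves =
    +-cancelˡ-≤ (leafCount deg) _ _ (≤-trans few-leaves n≤leafCount+backbone)

  long-path : ∀ {L} → 1 ≤ L → leafCount deg + L ≤ n → HasPathOfLength≥ E (L + 1)
  long-path 1≤L few-leaves
    with L≤backbone ← few-leaves⇒long-backbone few-leaves
    with _ , _ , _ , _ , _ , long ←
           extend-both-ends backbone-path (≤-trans 1≤L L≤backbone) on-backbone⇒2≤deg =
    HasPathOfLength≥-mono (+-monoˡ-≤ 1 L≤backbone) long

  2≤leafCount : 2 ≤ n → 2 ≤ leafCount deg
  2≤leafCount 2≤n with 1 ≤? length backbone
  ... | no empty =
    ≤-trans 2≤n (subst (n ≤_) (trans (cong (leafCount deg +_) (n<1⇒n≡0 (≰⇒> empty)))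
                                     (+-identityʳ _))
                       n≤leafCount+backbone)
  ... | yes nonempty with extend-both-ends backbone-path nonempty on-backbone⇒2≤deg
  ...   | u , w , u≢w , u∉ , w∉ , _ =
    subst (_≤ leafCount deg) (cong₂ _+_ (leaf u u∉) (leaf w w∉))
      (∑-pair _ (allFin⁺ n) (∈-allFin u) (∈-allFin w) u≢w)
    where
    leaf : ∀ v → v ∉ backbone → 𝟙 (deg v ≟ 1) ≡ 1
    leaf v v∉ rewrite off-backbone⇒leaf v v∉ = refl

∑-leafCount≤n : ∀ {k n} (D : Fin k → Fin n → ℕ) → NoCommonLeaves D →
                ∑ (λ i → leafCount (D i)) (allFin k) ≤ n
∑-leafCount≤n {k} {n} D no-common-leaves = begin
  ∑ (λ i → leafCount (D i)) (allFin k)                          ≡⟨ ∑-swap _ (allFin k) (allFin n) ⟩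
  ∑ (λ j → ∑ (λ i → 𝟙 (D i j ≟ 1)) (allFin k)) (allFin n)       ≤⟨ ∑-mono-≤ column≤1 (allFin n) ⟩
  ∑ (λ _ → 1) (allFin n)                                        ≡⟨ ∑-length (allFin n) ⟩
  length (allFin n)                                             ≡⟨ length-tabulate (λ j → j) ⟩
  n                                                             ∎
  where
  open ≤-Reasoning
  column≤1 : ∀ j → ∑ (λ i → 𝟙 (D i j ≟ 1)) (allFin k) ≤ 1
  column≤1 j = ∑-𝟙-atMostOne (λ i → D i j ≟ 1) (no-common-leaves j _ _) (allFin⁺ k)

m+2+t<ℓ+m⇒t+3≤ℓ : ∀ m t ℓ → m + 2 + t < ℓ + m → t + 3 ≤ ℓ
m+2+t<ℓ+m⇒t+3≤ℓ m t ℓ lt = +-cancelʳ-≤ m (t + 3) ℓ (subst (_≤ ℓ + m) (rearrange m t) lt)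
  where
  rearrange : ∀ m t → suc (m + 2 + t) ≡ t + 3 + m
  rearrange = solve-∀

-- With k = 4 + a and n = 2k + 2 + t: the colours other than c would need more leaves than there are vertices.
too-many-leaves : ∀ a t → 2 * (4 + a) + 2 + t < 2 + (3 + a) * (t + 3)
too-many-leaves a t = subst (suc (2 * (4 + a) + 2 + t) ≤_) (sym (expand a t)) (m≤m+n _ _)
  where
  expand : ∀ a t → 2 + (3 + a) * (t + 3) ≡ suc (2 * (4 + a) + 2 + t) + (a + 2 * t + a * t)
  expand = solve-∀

colour-with-few-leaves : ∀ {k n} (L : Fin k → ℕ) → 4 ≤ k → 2 * k + 2 ≤ n → ∑ L (allFin k) ≤ n →
                         ∀ c → 2 ≤ L c → ∃ λ i → i ≢ c × L i + 2 * k ≤ n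
colour-with-few-leaves {k} {n} L 4≤k 2k+2≤n total c 2≤Lc
  with any? (λ i → ¬? (i ≟ᶠ c) ×-dec (L i + 2 * k ≤? n)) (allFin k)
... | yes some = satisfied some
... | no none
  with s≤s (s≤s (s≤s (s≤s {n = a} _))) ← 4≤k
  with t , refl ← m≤n⇒∃[o]m+o≡n 2k+2≤n =
  contradiction (≤-trans too-few total) (<⇒≱ (too-many-leaves a t))
  where
  many-leaves : ∀ i → i ≢ c → t + 3 ≤ L i
  many-leaves i i≢c = m+2+t<ℓ+m⇒t+3≤ℓ (2 * k) t (L i)
    (≰⇒> λ few → none (Any.map (λ { refl → i≢c , few }) (∈-allFin i)))
  too-few : 2 + (3 + a) * (t + 3) ≤ ∑ L (allFin k)
  too-few = ≤-trans (+-monoˡ-≤ ((3 + a) * (t + 3)) 2≤Lc)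
    (subst (λ ℓ → L c + pred ℓ * (t + 3) ≤ ∑ L (allFin k)) (length-tabulate {n = k} (λ i → i))
      (∑-≥-except L (t + 3) (allFin⁺ k) (∈-allFin c) many-leaves))

mainTheorem8 : (k n : ℕ) (D : Fin k → Fin n → ℕ) →
    4 ≤ k → 2 * k + 2 ≤ n →
    IsTreeDegreeMatrix D → NoCommonLeaves D →
    (col : Colouring k n) → IsCaterpillarRealization D col →
    -- any k-1 of the k colours = all colours except one colour c
    (c : Fin k) → ∃ λ i → i ≢ c × HasPathOfLength≥ (colourClass col i) (2 * k + 1)
mainTheorem8 k n D 4≤k 2k+2≤n tree-degrees no-common-leaves col ((simple , degrees) , caterpillars) c =
  let (i , i≢c , few-leaves) = colour-with-few-leaves (λ i → leafCount (D i)) 4≤k 2k+2≤n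
                                 (∑-leafCount≤n D no-common-leaves) c
                                 (subst (2 ≤_) (leafCount-colour c) (Colour.2≤leafCount c 2≤n))
  in i , i≢c , Colour.long-path i 1≤2k (subst (λ ℓ → ℓ + 2 * k ≤ n) (sym (leafCount-colour i)) few-leaves)
  where
  E-sym : ∀ i {u v} → colourClass col i u v → colourClass col i v u
  E-sym i {u} {v} e = trans (proj₁ simple v u) e

  irrefl : ∀ i {v} → ¬ colourClass col i v v
  irrefl i {v} e with () ← trans (sym (proj₂ simple v)) e

  no-isolated : ∀ i v → 1 ≤ degree (colourClass col i) (colourClass? col i) v
  no-isolated i v = subst (1 ≤_) (sym (degrees i v)) (proj₁ (tree-degrees i) v)

  module Colour (i : Fin k) = Caterpillar (E-sym i) (irrefl i) (no-isolated i) (caterpillars i)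

  leafCount-colour : ∀ i → leafCount (degree (colourClass col i) (colourClass? col i)) ≡ leafCount (D i)
  leafCount-colour i = leafCount-cong (degrees i)

  2≤n : 2 ≤ n
  2≤n = ≤-trans (m≤n+m 2 (2 * k)) 2k+2≤n

  1≤2k : 1 ≤ 2 * k
  1≤2k = ≤-trans (≤-trans (s≤s z≤n) 4≤k) (m≤m+n k (k + 0))
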